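{- Let $(L,\mathcal{U})$ be a topological residuated lattice and $F$ a filter of $L$. Then $F$ is open (respectively, closed) if and only if $a/F$ is open (respectively, closed) for every $a\in L$.
   Context: A residuated lattice is an algebra $(L,\wedge,\vee,\odot,\rightarrow,0,1)$ such that $(L,\wedge,\vee,0,1)$ is a bounded lattice, $(L,\odot,1)$ is a commutative monoid, and $x\odot y\le z$ iff $x\le y\rightarrow z$. A topological residuated lattice is a residuated lattice with a topology making $\wedge,\vee,\odot,\rightarrow$ continuous. A filter is a nonempty subset closed under $\odot$ and upward closed; for a filter $F$, $a/F$ is the class of $a$ under the congruence $\theta_F=\{(x,y):(x\rightarrow y)\odot(y\rightarrow x)\in F\}$. -}

module Defs where

open import Level using (0ℓ)
open import Data.Unit using (⊤)
open import Data.Empty using (⊥)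
open import Data.Product using (Σ; ∃; _×_; _,_)
open import Relation.Nullary using (¬_)
open import Relation.Binary.PropositionalEquality using (_≡_)
open import Algebra.Lattice.Structures using (IsLattice)
open import Algebra.Structures using (IsCommutativeMonoid)
open import Function.Bundles using (_⇔_)

Subset : Set → Set₁
Subset A = A → Set

-- Opens are closed under arbitrary unions (indexed by any I : Set),
-- binary intersections, contain the whole space, and (since subsets are
-- predicates) are invariant under pointwise logical equivalence
-- (extensionality of subsets).
record Topology (X : Set) : Set₁ where
  field
    IsOpen      : Subset X → Set
    open-ext    : ∀ {U V : Subset X} → IsOpen U → (∀ x → U x ⇔ V x) → IsOpen V
    open-univ   : IsOpen (λ _ → ⊤)
    open-∩      : ∀ {U V : Subset X} → IsOpen U → IsOpen V → IsOpen (λ x → U x × V x)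
    open-⋃      : ∀ (I : Set) (U : I → Subset X) → (∀ i → IsOpen (U i))
                  → IsOpen (λ x → ∃ λ i → U i x)

  IsClosed : Subset X → Set
  IsClosed C = IsOpen (λ x → ¬ C x)

  -- Continuity of a binary operation X × X → X w.r.t. the product topology:
  -- the preimage of every open set is open in the product topology, i.e.
  -- every point of the preimage has an open rectangle neighbourhood inside it.
  Continuous₂ : (X → X → X) → Set₁
  Continuous₂ f = ∀ (U : Subset X) → IsOpen U → ∀ x y → U (f x y) →
    Σ (Subset X) λ V → Σ (Subset X) λ W →
      IsOpen V × IsOpen W × V x × W y × (∀ x' y' → V x' → W y' → U (f x' y'))

record ResiduatedLattice : Set₁ where
  infixr 7 _∧_
  infixr 6 _∨_
  infixr 7 _⊙_
  infixr 5 _⇒_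
  infix 4 _≤_
  field
    Carrier   : Set
    _∧_ _∨_ _⊙_ _⇒_ : Carrier → Carrier → Carrier
    𝟘 𝟙       : Carrier
    isLattice : IsLattice _≡_ _∨_ _∧_
    ⊙-isCommutativeMonoid : IsCommutativeMonoid _≡_ _⊙_ 𝟙

  _≤_ : Carrier → Carrier → Set
  x ≤ y = x ∧ y ≡ x

  field
    𝟘-least    : ∀ x → 𝟘 ≤ x
    𝟙-greatest : ∀ x → x ≤ 𝟙
    residuation : ∀ x y z → (x ⊙ y ≤ z) ⇔ (x ≤ y ⇒ z)

  record IsFilter (F : Subset Carrier) : Set where
    field
      nonempty : ∃ λ x → F x
      ⊙-closed : ∀ {x y} → F x → F y → F (x ⊙ y)
      up-closed : ∀ {x y} → F x → x ≤ y → F y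

  -- a/F : the class of a under θ_F = {(x,y) : (x ⇒ y) ⊙ (y ⇒ x) ∈ F}
  _/_ : Carrier → Subset Carrier → Subset Carrier
  (a / F) x = F ((a ⇒ x) ⊙ (x ⇒ a))

record TopologicalResiduatedLattice : Set₁ where
  field
    rl : ResiduatedLattice
  open ResiduatedLattice rl public
  field
    topology : Topology Carrier
  open Topology topology public
  field
    ∧-cont : Continuous₂ _∧_
    ∨-cont : Continuous₂ _∨_
    ⊙-cont : Continuous₂ _⊙_
    ⇒-cont : Continuous₂ _⇒_

{-# OPTIONS --safe #-}
-- Each class a/F is the preimage of F under the continuous map x ↦ (a ⇒ x) ⊙ (x ⇒ a),
-- so it is open (closed) whenever F is; conversely F itself is the class 𝟙/F,
-- since (𝟙 ⇒ x) ⊙ (x ⇒ 𝟙) = x ⊙ 𝟙 = x.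
module Submission where

open import Defs
open import Data.Product using (_×_; _,_; Σ; ∃; proj₁; proj₂)
open import Function.Base using (_∘_)
open import Function.Bundles using (_⇔_; mk⇔; Equivalence)
open import Function.Related.TypeIsomorphisms using (¬-cong-⇔)
open import Relation.Binary.PropositionalEquality
  using (_≡_; sym; trans; subst)
open import Algebra.Lattice.Bundles using (Lattice)
open import Algebra.Lattice.Structures using (module IsLattice)
open import Algebra.Structures using (IsCommutativeMonoid)
import Algebra.Lattice.Properties.Lattice as LatticeProperties

module TopologyProperties {X : Set} (τ : Topology X) where
  open Topology τ

  Continuous : (X → X) → Set₁
  Continuous f = ∀ (U : Subset X) → IsOpen U → ∀ x → U (f x) →
    Σ (Subset X) λ V → IsOpen V × V x × (∀ y → V y → U (f y))

  -- An open set is the union of the open neighbourhoods it contains.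
  continuous⇒preimage-open : ∀ {f} → Continuous f →
                             ∀ {U} → IsOpen U → IsOpen (U ∘ f)
  continuous⇒preimage-open {f} f-cont {U} U-open =
    open-ext (open-⋃ (∃ (U ∘ f)) nbhd nbhd-open) ⋃nbhd⇔preimage
    where
    nbhd : ∃ (U ∘ f) → Subset X
    nbhd (x , fx∈U) = proj₁ (f-cont U U-open x fx∈U)

    nbhd-open : ∀ i → IsOpen (nbhd i)
    nbhd-open (x , fx∈U) = proj₁ (proj₂ (f-cont U U-open x fx∈U))

    ⋃nbhd⇔preimage : ∀ y → (∃ λ i → nbhd i y) ⇔ U (f y)
    ⋃nbhd⇔preimage y = mk⇔
      (λ { ((x , fx∈U) , y∈V) → proj₂ (proj₂ (proj₂ (f-cont U U-open x fx∈U))) y y∈V })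
      (λ fy∈U → (y , fy∈U) , proj₁ (proj₂ (proj₂ (f-cont U U-open y fy∈U))))

  continuous⇒preimage-closed : ∀ {f} → Continuous f →
                               ∀ {C} → IsClosed C → IsClosed (C ∘ f)
  continuous⇒preimage-closed f-cont = continuous⇒preimage-open f-cont

  continuous-const : ∀ c → Continuous (λ _ → c)
  continuous-const c U _ _ c∈U = (λ _ → _) , open-univ , _ , λ _ _ → c∈U

  continuous-id : Continuous (λ x → x)
  continuous-id U U-open _ x∈U = U , U-open , x∈U , λ _ y∈U → y∈U

  continuous₂-∘ : ∀ {h f g} → Continuous₂ h → Continuous f → Continuous g →
                  Continuous (λ x → h (f x) (g x))
  continuous₂-∘ {h} {f} {g} h-cont f-cont g-cont U U-open x hfxgx∈U
    with h-cont U U-open (f x) (g x) hfxgx∈U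
  ... | V , W , V-open , W-open , fx∈V , gx∈W , VW⊆h⁻¹U
    with f-cont V V-open x fx∈V | g-cont W W-open x gx∈W
  ... | V′ , V′-open , x∈V′ , V′⊆f⁻¹V | W′ , W′-open , x∈W′ , W′⊆g⁻¹W =
    (λ y → V′ y × W′ y) , open-∩ V′-open W′-open , (x∈V′ , x∈W′) ,
    λ { y (y∈V′ , y∈W′) → VW⊆h⁻¹U (f y) (g y) (V′⊆f⁻¹V y y∈V′) (W′⊆g⁻¹W y y∈W′) }

module ResiduatedLatticeProperties (L : ResiduatedLattice) where
  open ResiduatedLattice L
  open IsLattice isLattice using (∧-comm)

  lattice : Lattice _ _
  lattice = record { isLattice = isLattice }

  open LatticeProperties lattice using (∧-idem)
  open IsCommutativeMonoid ⊙-isCommutativeMonoid using (identityʳ; ∙-cong)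
  open Equivalence using (to; from)

  ≤-refl : ∀ x → x ≤ x
  ≤-refl = ∧-idem

  ≤-antisym : ∀ {x y} → x ≤ y → y ≤ x → x ≡ y
  ≤-antisym {x} {y} x≤y y≤x = trans (sym x≤y) (trans (∧-comm x y) y≤x)

  biresiduum : Carrier → Carrier → Carrier
  biresiduum a x = (a ⇒ x) ⊙ (x ⇒ a)

  𝟙⇒x≡x : ∀ x → 𝟙 ⇒ x ≡ x
  𝟙⇒x≡x x = ≤-antisym 𝟙⇒x≤x x≤𝟙⇒x
    where
    𝟙⇒x≤x : 𝟙 ⇒ x ≤ x
    𝟙⇒x≤x = subst (_≤ x) (identityʳ (𝟙 ⇒ x)) (from (residuation (𝟙 ⇒ x) 𝟙 x) (≤-refl _))
    x≤𝟙⇒x : x ≤ 𝟙 ⇒ x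
    x≤𝟙⇒x = to (residuation x 𝟙 x) (subst (_≤ x) (sym (identityʳ x)) (≤-refl x))

  x⇒𝟙≡𝟙 : ∀ x → x ⇒ 𝟙 ≡ 𝟙
  x⇒𝟙≡𝟙 x = ≤-antisym (𝟙-greatest _) (to (residuation 𝟙 x 𝟙) (𝟙-greatest _))

  biresiduum-𝟙 : ∀ x → biresiduum 𝟙 x ≡ x
  biresiduum-𝟙 x = trans (∙-cong (𝟙⇒x≡x x) (x⇒𝟙≡𝟙 x)) (identityʳ x)

  𝟙/F⇔F : ∀ (F : Subset Carrier) x → (𝟙 / F) x ⇔ F x
  𝟙/F⇔F F x = mk⇔ (subst F (biresiduum-𝟙 x)) (subst F (sym (biresiduum-𝟙 x)))

module TopologicalResiduatedLatticeProperties (T : TopologicalResiduatedLattice) where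
  open TopologicalResiduatedLattice T
  open TopologyProperties topology
  open ResiduatedLatticeProperties rl

  biresiduum-continuous : ∀ a → Continuous (biresiduum a)
  biresiduum-continuous a =
    continuous₂-∘ ⊙-cont (continuous₂-∘ ⇒-cont (continuous-const a) continuous-id)
                         (continuous₂-∘ ⇒-cont continuous-id (continuous-const a))

lemma7p19 : (T : TopologicalResiduatedLattice) →
    let open TopologicalResiduatedLattice T in
    (F : Subset Carrier) → IsFilter F →
    (IsOpen F ⇔ (∀ a → IsOpen (a / F))) × (IsClosed F ⇔ (∀ a → IsClosed (a / F)))
lemma7p19 T F _ =
  mk⇔ (λ F-open a → continuous⇒preimage-open (biresiduum-continuous a) F-open)
      (λ classes-open → open-ext (classes-open 𝟙) (𝟙/F⇔F F)) ,
  mk⇔ (λ F-closed a → continuous⇒preimage-closed (biresiduum-continuous a) F-closed)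
      (λ classes-closed → open-ext (classes-closed 𝟙) (λ x → ¬-cong-⇔ (𝟙/F⇔F F x)))
  where
  open TopologicalResiduatedLattice T
  open TopologyProperties topology
  open ResiduatedLatticeProperties rl
  open TopologicalResiduatedLatticeProperties T
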